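{- For every $n\ge 1$, the path $P_n$ on $n$ vertices satisfies $\phi(P_n)<0.81\,\beta^n$, where $\beta=6^{1/4}$.
   Context: A subset of vertices $F$ of a graph $G$ is a dissociation set if the induced subgraph $G[F]$ has maximum degree at most $1$. A maximal dissociation set is a dissociation set that is not a proper subset of any other dissociation set. $\phi(G)$ denotes the number of maximal dissociation sets of $G$. -}

module Defs where

open import Data.Nat using (ℕ; zero; suc; _≤_)
open import Data.Nat.Properties using (_≤?_)
import Data.Nat.Properties as ℕP
open import Data.Fin using (Fin; toℕ)
open import Data.Fin.Subset using (Subset; _∈_; _⊂_; inside; outside)
open import Data.Fin.Subset.Properties using (_∈?_; _⊂?_; anySubset?)
open import Data.Fin.Properties using (all?)
open import Data.List using (List; []; _∷_; length; filter; map; _++_)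
open import Data.Vec using (Vec; []; _∷_)
open import Data.Product using (Σ; _×_; _,_)
open import Data.Sum using (_⊎_)
open import Data.Unit using (⊤; tt)
open import Data.Empty using (⊥)
open import Relation.Nullary using (Dec; ¬_; yes; no)
open import Relation.Nullary.Decidable using (_×-dec_; _⊎-dec_; ¬?; _→-dec_)
open import Relation.Binary.PropositionalEquality using (_≡_)

record Graph (n : ℕ) : Set₁ where
  field
    Adj     : Fin n → Fin n → Set
    adj?    : (u v : Fin n) → Dec (Adj u v)
    symm    : ∀ {u v} → Adj u v → Adj v u
    irrefl  : ∀ {u} → ¬ Adj u u
open Graph public

PathAdj : ∀ {n} → Fin n → Fin n → Set
PathAdj i j = (suc (toℕ i) ≡ toℕ j) ⊎ (suc (toℕ j) ≡ toℕ i)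

pathIrrefl : ∀ {n} {u : Fin n} → ¬ PathAdj u u
pathIrrefl (Data.Sum.inj₁ e) = ℕP.1+n≢n e
pathIrrefl (Data.Sum.inj₂ e) = ℕP.1+n≢n e

pathSymm : ∀ {n} {u v : Fin n} → PathAdj u v → PathAdj v u
pathSymm (Data.Sum.inj₁ e) = Data.Sum.inj₂ e
pathSymm (Data.Sum.inj₂ e) = Data.Sum.inj₁ e

P : (n : ℕ) → Graph n
P n = record
  { Adj    = PathAdj
  ; adj?   = λ i j → (suc (toℕ i) ℕP.≟ toℕ j) ⊎-dec (suc (toℕ j) ℕP.≟ toℕ i)
  ; symm   = pathSymm
  ; irrefl = pathIrrefl
  }

allVertices : (n : ℕ) → List (Fin n)
allVertices n = Data.List.allFin n

degIn : ∀ {n} (G : Graph n) (F : Subset n) (v : Fin n) → ℕ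
degIn {n} G F v = length (filter (λ u → (u ∈? F) ×-dec adj? G v u) (allVertices n))

IsDissociation : ∀ {n} (G : Graph n) (F : Subset n) → Set
IsDissociation G F = ∀ v → v ∈ F → degIn G F v ≤ 1

dissociation? : ∀ {n} (G : Graph n) (F : Subset n) → Dec (IsDissociation G F)
dissociation? G F = all? (λ v → (v ∈? F) →-dec (degIn G F v ≤? 1))

IsMaximalDissociation : ∀ {n} (G : Graph n) (F : Subset n) → Set
IsMaximalDissociation G F =
  IsDissociation G F × ¬ (Σ (Subset _) λ F' → F ⊂ F' × IsDissociation G F')

maximalDissociation? : ∀ {n} (G : Graph n) (F : Subset n) → Dec (IsMaximalDissociation G F)
maximalDissociation? G F =
  dissociation? G F ×-dec ¬? (anySubset? (λ F' → (F ⊂? F') ×-dec dissociation? G F'))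

allSubsets : (n : ℕ) → List (Subset n)
allSubsets zero    = [] ∷ []
allSubsets (suc n) = map (outside ∷_) (allSubsets n) ++ map (inside ∷_) (allSubsets n)

φ : ∀ {n} → Graph n → ℕ
φ {n} G = length (filter (maximalDissociation? G) (allSubsets n))

{-# OPTIONS --safe #-}
module Submission where

-- Read a subset F of P_n as a 0/1-word; F is a dissociation set iff the word has no three
-- consecutive 1s. If F is maximal, the padded word 0F0 moreover avoids 000, 0100 and 0010,
-- since in each of these a 0 can be switched to 1 without creating three consecutive 1s.
-- Words avoiding these windows are counted by a transfer operator on the last three letters,
-- and a weight w with 2·(transfer w) ≤ 3·w shows that their number grows at most like (3/2)^n.
-- As (3/2)^4 = 81/16 < 6, this gives the bound for n ≥ 4; n ≤ 3 is a direct computation.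

open import Defs
open import Data.Bool using (Bool; true; false; _∧_; _∨_; not; if_then_else_; T)
open import Data.Bool.Properties using (T-∧; ∧-zeroʳ; ∧-identityʳ; if-∧; if-cong-then)
open import Data.Fin using (Fin; zero; suc; toℕ)
open import Data.Fin.Subset using (Subset; _∈_; _⊂_; inside; outside)
open import Data.Fin.Subset.Properties using (_∈?_; ⊆-refl; out⊂in; s⊂s)
open import Data.List using (List; []; _∷_; _++_; _∷ʳ_; length; filter; map; allFin)
open import Data.List.Properties using (map-tabulate)
open import Data.Nat using (ℕ; zero; suc; _+_; _*_; _^_; _≤_; _<_; z≤n; s≤s; _≡ᵇ_; _≤ᵇ_)
open import Data.Nat.Properties
open import Algebra.Properties.CommutativeSemigroup *-commutativeSemigroup using (x∙yz≈y∙xz)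
open import Data.Nat.Solver using (module +-*-Solver)
open import Data.Product using (_,_; proj₁; proj₂; ∃-syntax; _×_)
open import Data.Sum using (_⊎_; inj₁; inj₂; [_,_]′)
open import Data.Unit using (tt)
open import Data.Vec using ([]; _∷_; here; there; toList)
open import Function using (_∘_; id)
open import Function.Bundles using (Equivalence)
open import Relation.Nullary using (¬_; does; yes; no; contradiction; _×-dec_)
open import Relation.Unary using (Pred; Decidable)
open import Relation.Binary.PropositionalEquality

open Equivalence using (to; from)
open +-*-Solver

bit : Bool → ℕ
bit b = if b then 1 else 0

count : ∀ {a} {A : Set a} → (A → Bool) → List A → ℕ
count p []       = 0
count p (x ∷ xs) = bit (p x) + count p xs

module _ {a} {A : Set a} where

  count-++ : ∀ p (xs ys : List A) → count p (xs ++ ys) ≡ count p xs + count p ys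
  count-++ p []       ys = refl
  count-++ p (x ∷ xs) ys = trans (cong (bit (p x) +_) (count-++ p xs ys)) (sym (+-assoc (bit (p x)) _ _))

  count-map : ∀ {b} {B : Set b} p (f : B → A) xs → count p (map f xs) ≡ count (p ∘ f) xs
  count-map p f []       = refl
  count-map p f (x ∷ xs) = cong (bit (p (f x)) +_) (count-map p f xs)

  count-cong : ∀ {p q : A → Bool} → (∀ x → p x ≡ q x) → ∀ xs → count p xs ≡ count q xs
  count-cong p≗q []       = refl
  count-cong p≗q (x ∷ xs) = cong₂ _+_ (cong bit (p≗q x)) (count-cong p≗q xs)

  count-none : ∀ {p : A → Bool} → (∀ x → p x ≡ false) → ∀ xs → count p xs ≡ 0
  count-none none []       = refl
  count-none none (x ∷ xs) rewrite none x = count-none none xs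

  count-∧ : ∀ b (p : A → Bool) xs → count (λ x → b ∧ p x) xs ≡ (if b then count p xs else 0)
  count-∧ true  p xs       = refl
  count-∧ false p []       = refl
  count-∧ false p (x ∷ xs) = count-∧ false p xs

  module _ {ℓ} {P : Pred A ℓ} (P? : Decidable P) where

    length-filter≡count : ∀ xs → length (filter P? xs) ≡ count (does ∘ P?) xs
    length-filter≡count []       = refl
    length-filter≡count (x ∷ xs) with does (P? x)
    ... | true  = cong suc (length-filter≡count xs)
    ... | false = length-filter≡count xs

    length-filter≤count : ∀ (p : A → Bool) → (∀ x → P x → T (p x)) →
                          ∀ xs → length (filter P? xs) ≤ count p xs
    length-filter≤count p P⇒p []       = z≤n
    length-filter≤count p P⇒p (x ∷ xs) with P? x
    ... | no _ = ≤-trans (length-filter≤count p P⇒p xs) (m≤n+m _ (bit (p x)))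
    ... | yes Px with p x | P⇒p x Px
    ...   | true | _ = s≤s (length-filter≤count p P⇒p xs)

count-allFin-suc : ∀ {n} (p : Fin (suc n) → Bool) →
                   count p (allFin (suc n)) ≡ bit (p zero) + count (p ∘ suc) (allFin n)
count-allFin-suc {n} p =
  cong (bit (p zero) +_) (trans (cong (count p) (sym (map-tabulate id suc))) (count-map p suc (allFin n)))

allᵇ : (Bool → Bool) → Bool
allᵇ p = p false ∧ p true

allᵇ-sound : ∀ p → T (allᵇ p) → ∀ x → T (p x)
allᵇ-sound p all false = proj₁ (T-∧ .to all)
allᵇ-sound p all true  = proj₂ (T-∧ .to all)

∀-states-by-computation : ∀ (p : Bool → Bool → Bool → Bool) →
  {T (allᵇ λ a → allᵇ λ b → allᵇ λ c → p a b c)} → ∀ a b c → T (p a b c)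
∀-states-by-computation p {all} a b c =
  allᵇ-sound (p a b) (allᵇ-sound (λ b → allᵇ (p a b))
    (allᵇ-sound (λ a → allᵇ λ b → allᵇ (p a b)) all a) b) c

^-distribʳ-* : ∀ a b m → (a * b) ^ m ≡ a ^ m * b ^ m
^-distribʳ-* a b zero    = refl
^-distribʳ-* a b (suc m) =
  trans (cong (a * b *_) (^-distribʳ-* a b m)) ([m*n]*[o*p]≡[m*o]*[n*p] a b (a ^ m) (b ^ m))

[m^n]^o≡[m^o]^n : ∀ a m k → (a ^ m) ^ k ≡ (a ^ k) ^ m
[m^n]^o≡[m^o]^n a m k = trans (^-*-assoc a m k) (trans (cong (a ^_) (*-comm m k)) (sym (^-*-assoc a k m)))

incident : ∀ {n} → Subset n → Fin n → Fin n → Bool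
incident F v u = does (u ∈? F) ∧ does (adj? (P _) v u)

degIn≡count : ∀ {n} (F : Subset n) v → degIn (P n) F v ≡ count (incident F v) (allFin n)
degIn≡count {n} F v = length-filter≡count (λ u → (u ∈? F) ×-dec adj? (P n) v u) (allFin n)

does-zero∈? : ∀ {n} x (F : Subset n) → does (zero ∈? x ∷ F) ≡ x
does-zero∈? true  F = refl
does-zero∈? false F = refl

degIn-suc : ∀ {n} x (F : Subset n) v →
            degIn (P (suc n)) (x ∷ F) (suc v) ≡ bit (x ∧ (0 ≡ᵇ toℕ v)) + degIn (P n) F v
degIn-suc x F v =
  trans (degIn≡count (x ∷ F) (suc v))
    (trans (count-allFin-suc (incident (x ∷ F) (suc v)))
      (cong₂ _+_ (cong (λ b → bit (b ∧ (0 ≡ᵇ toℕ v))) (does-zero∈? x F)) (sym (degIn≡count F v))))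

degIn-zero : ∀ {n} x y (F : Subset n) → degIn (P (suc (suc n))) (x ∷ y ∷ F) zero ≡ bit y
degIn-zero {n} x y F = begin
  degIn (P (suc (suc n))) (x ∷ y ∷ F) zero
    ≡⟨ degIn≡count (x ∷ y ∷ F) zero ⟩
  count f (allFin (suc (suc n)))
    ≡⟨ count-allFin-suc f ⟩
  bit (f zero) + count (λ u → f (suc u)) (allFin (suc n))
    ≡⟨ cong (bit (f zero) +_) (count-allFin-suc (λ u → f (suc u))) ⟩
  bit (f zero) + (bit (f (suc zero)) + count (λ u → f (suc (suc u))) (allFin n))
    ≡⟨ cong₂ (λ a b → bit a + (bit b + count (λ u → f (suc (suc u))) (allFin n)))
             (∧-zeroʳ (does (zero ∈? x ∷ y ∷ F)))
             (trans (∧-identityʳ (does (zero ∈? y ∷ F))) (does-zero∈? y F)) ⟩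
  bit y + count (λ u → f (suc (suc u))) (allFin n)
    ≡⟨ cong (bit y +_) (count-none (λ u → ∧-zeroʳ (does (u ∈? F))) (allFin n)) ⟩
  bit y + 0
    ≡⟨ +-identityʳ (bit y) ⟩
  bit y ∎
  where
  open ≡-Reasoning
  f : Fin (suc (suc n)) → Bool
  f = incident (x ∷ y ∷ F) zero

degIn-singleton : ∀ x → degIn (P 1) (x ∷ []) zero ≡ 0
degIn-singleton true  = refl
degIn-singleton false = refl

tripleFree : List Bool → Bool
tripleFree (a ∷ b ∷ c ∷ w) = not (a ∧ b ∧ c) ∧ tripleFree (b ∷ c ∷ w)
tripleFree _               = true

tripleFree-tail : ∀ x w → T (tripleFree (x ∷ w)) → T (tripleFree w)
tripleFree-tail x (b ∷ c ∷ w) t = proj₂ (T-∧ .to t)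
tripleFree-tail x []          t = tt
tripleFree-tail x (b ∷ [])    t = tt

dissociation-tail : ∀ {n} x (F : Subset n) →
                    IsDissociation (P (suc n)) (x ∷ F) → IsDissociation (P n) F
dissociation-tail x F D v v∈F = begin
  degIn (P _) F v                                ≤⟨ m≤n+m _ _ ⟩
  bit (x ∧ (0 ≡ᵇ toℕ v)) + degIn (P _) F v       ≡⟨ degIn-suc x F v ⟨
  degIn (P _) (x ∷ F) (suc v)                    ≤⟨ D (suc v) (there v∈F) ⟩
  1                                              ∎
  where open ≤-Reasoning

dissociation⇒tripleFree : ∀ {n} (F : Subset n) → IsDissociation (P n) F → T (tripleFree (toList F))
dissociation⇒tripleFree []            D = tt
dissociation⇒tripleFree (x ∷ [])      D = tt
dissociation⇒tripleFree (x ∷ y ∷ [])  D = tt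
dissociation⇒tripleFree (x ∷ y ∷ z ∷ F) D =
  T-∧ .from (notThree x y z D , dissociation⇒tripleFree (y ∷ z ∷ F) (dissociation-tail x _ D))
  where
  notThree : ∀ x y z → IsDissociation (P _) (x ∷ y ∷ z ∷ F) → T (not (x ∧ y ∧ z))
  notThree true true true D =
    contradiction (subst (_≤ 1) middle-degree (D (suc zero) (there here))) λ { (s≤s ()) }
    where
    middle-degree : degIn (P _) (true ∷ true ∷ true ∷ F) (suc zero) ≡ 2
    middle-degree = trans (degIn-suc true (true ∷ true ∷ F) zero) (cong suc (degIn-zero true true F))
  notThree true  true  false _ = tt
  notThree true  false z     _ = tt
  notThree false y     z     _ = tt

bit≤1 : ∀ b → bit b ≤ 1
bit≤1 true  = s≤s z≤n
bit≤1 false = z≤n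

degIn-suc≤1 : ∀ {n} x (F : Subset n) v → v ∈ F → T (tripleFree (x ∷ toList F)) →
              degIn (P n) F v ≤ 1 → bit (x ∧ (0 ≡ᵇ toℕ v)) + degIn (P n) F v ≤ 1
degIn-suc≤1 false F v _ _ deg≤1 = deg≤1
degIn-suc≤1 true F (suc v) _ _ deg≤1 = deg≤1
degIn-suc≤1 true (true ∷ []) zero here _ _ rewrite degIn-singleton true = s≤s z≤n
degIn-suc≤1 true (true ∷ false ∷ F) zero here _ _ rewrite degIn-zero true false F = s≤s z≤n
degIn-suc≤1 true (true ∷ true ∷ F) zero here () _

tripleFree⇒dissociation : ∀ {n} (F : Subset n) → T (tripleFree (toList F)) → IsDissociation (P n) F
tripleFree⇒dissociation (x ∷ []) _ zero _ = subst (_≤ 1) (sym (degIn-singleton x)) z≤n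
tripleFree⇒dissociation (x ∷ y ∷ F) _ zero _ = subst (_≤ 1) (sym (degIn-zero x y F)) (bit≤1 y)
tripleFree⇒dissociation (x ∷ F) t (suc v) (there v∈F) =
  subst (_≤ 1) (sym (degIn-suc x F v))
    (degIn-suc≤1 x F v v∈F t (tripleFree⇒dissociation F (tripleFree-tail x (toList F) t) v v∈F))

tripleFree-0∷ : ∀ w → tripleFree (false ∷ w) ≡ tripleFree w
tripleFree-0∷ []          = refl
tripleFree-0∷ (b ∷ [])    = refl
tripleFree-0∷ (b ∷ c ∷ w) = refl

tripleFree-∷0∷ : ∀ a w → tripleFree (a ∷ false ∷ w) ≡ tripleFree w
tripleFree-∷0∷ false w       = trans (tripleFree-0∷ (false ∷ w)) (tripleFree-0∷ w)
tripleFree-∷0∷ true  []      = refl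
tripleFree-∷0∷ true  (b ∷ w) = tripleFree-0∷ (b ∷ w)

window3 : Bool → Bool → Bool → Bool
window3 a b c = not (a ∧ b ∧ c) ∧ (a ∨ b ∨ c)

window4 : Bool → Bool → Bool → Bool → Bool
window4 a b c e = not (not a ∧ b ∧ not c ∧ not e) ∧ not (not a ∧ not b ∧ c ∧ not e)

admissible : List Bool → Bool
admissible (a ∷ b ∷ c ∷ e ∷ w) = window3 a b c ∧ window4 a b c e ∧ admissible (b ∷ c ∷ e ∷ w)
admissible (a ∷ b ∷ c ∷ [])    = window3 a b c
admissible _                   = true

-- The last letter is never switched: in the words used it is the right padding.
data Raise : List Bool → List Bool → Set where
  raise-here  : ∀ {y w} → Raise (false ∷ y ∷ w) (true ∷ y ∷ w)
  raise-there : ∀ {x w w'} → Raise w w' → Raise (x ∷ w) (x ∷ w')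

-- Quantifying over the left context y ∷ x is what lets defect-∷ move a switch one letter right.
Defect : Bool → List Bool → Set
Defect x w = ¬ T (tripleFree (x ∷ w))
           ⊎ ∃[ w' ] Raise w w' × (∀ y → tripleFree (y ∷ x ∷ w') ≡ tripleFree (y ∷ x ∷ w))

window3-defect : ∀ x b c w → window3 x b c ≡ false → Defect x (b ∷ c ∷ w)
window3-defect true  true  true  w _ = inj₁ λ ()
window3-defect false false false w _ = inj₂ (true ∷ false ∷ w , raise-here , λ y →
  trans (trans (tripleFree-∷0∷ y (true ∷ false ∷ w)) (tripleFree-∷0∷ true w))
        (sym (trans (tripleFree-∷0∷ y (false ∷ false ∷ w)) (tripleFree-∷0∷ false w))))
window3-defect true  true  false _ ()
window3-defect true  false _     _ ()
window3-defect false true  _     _ ()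
window3-defect false false true  _ ()

window4-defect : ∀ x b c e w → window4 x b c e ≡ false → Defect x (b ∷ c ∷ e ∷ w)
window4-defect false true false false w _ =
  inj₂ (true ∷ true ∷ false ∷ w , raise-there raise-here , λ y →
    trans (trans (tripleFree-∷0∷ y (true ∷ true ∷ false ∷ w)) (tripleFree-∷0∷ true w))
          (sym (trans (tripleFree-∷0∷ y (true ∷ false ∷ false ∷ w))
                      (trans (tripleFree-∷0∷ true (false ∷ w)) (tripleFree-0∷ w)))))
window4-defect false false true false w _ =
  inj₂ (true ∷ true ∷ false ∷ w , raise-here , λ y →
    trans (trans (tripleFree-∷0∷ y (true ∷ true ∷ false ∷ w)) (tripleFree-∷0∷ true w))
          (sym (trans (tripleFree-∷0∷ y (false ∷ true ∷ false ∷ w)) (tripleFree-∷0∷ true w))))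
window4-defect true  _     _     _     _ ()
window4-defect false true  true  _     _ ()
window4-defect false true  false true  _ ()
window4-defect false false true  true  _ ()
window4-defect false false false _     _ ()

defect-∷ : ∀ x b c w → Defect b (c ∷ w) → Defect x (b ∷ c ∷ w)
defect-∷ x b c w (inj₁ bad) = inj₁ (bad ∘ tripleFree-tail x (b ∷ c ∷ w))
defect-∷ x b c w (inj₂ (c' ∷ w' , r , same)) =
  inj₂ (b ∷ c' ∷ w' , raise-there r , λ y → cong (not (y ∧ x ∧ b) ∧_) (same x))

admissible-∷-false : ∀ x b c e w → admissible (x ∷ b ∷ c ∷ e ∷ w) ≡ false →
  window3 x b c ≡ false ⊎ window4 x b c e ≡ false ⊎ admissible (b ∷ c ∷ e ∷ w) ≡ false
admissible-∷-false x b c e w bad with window3 x b c | window4 x b c e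
... | false | _     = inj₁ refl
... | true  | false = inj₂ (inj₁ refl)
... | true  | true  = inj₂ (inj₂ bad)

admissible-defect : ∀ x w → admissible (x ∷ w) ≡ false → Defect x w
admissible-defect x (b ∷ c ∷ []) bad = window3-defect x b c [] bad
admissible-defect x (b ∷ c ∷ e ∷ w) bad =
  [ window3-defect x b c (e ∷ w)
  , [ window4-defect x b c e w
    , defect-∷ x b c (e ∷ w) ∘ admissible-defect b (c ∷ e ∷ w) ]′ ]′
  (admissible-∷-false x b c e w bad)

word : ∀ {n} → Subset n → List Bool
word F = toList F ∷ʳ false

tripleFree-∷ʳ0 : ∀ w → tripleFree (w ∷ʳ false) ≡ tripleFree w
tripleFree-∷ʳ0 []                 = refl
tripleFree-∷ʳ0 (a ∷ [])           = refl
tripleFree-∷ʳ0 (false ∷ b ∷ [])   = refl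
tripleFree-∷ʳ0 (true ∷ false ∷ []) = refl
tripleFree-∷ʳ0 (true ∷ true ∷ [])  = refl
tripleFree-∷ʳ0 (a ∷ b ∷ c ∷ w)    = cong (not (a ∧ b ∧ c) ∧_) (tripleFree-∷ʳ0 (b ∷ c ∷ w))

tripleFree-word : ∀ {n} (F : Subset n) → tripleFree (false ∷ word F) ≡ tripleFree (toList F)
tripleFree-word F = trans (tripleFree-0∷ (word F)) (tripleFree-∷ʳ0 (toList F))

raise-superset : ∀ {n} (F : Subset n) {w'} → Raise (word F) w' → ∃[ F' ] F ⊂ F' × w' ≡ word F'
raise-superset (false ∷ [])    raise-here = true ∷ [] , out⊂in ⊆-refl , refl
raise-superset (false ∷ z ∷ F) raise-here = true ∷ z ∷ F , out⊂in ⊆-refl , refl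
raise-superset (x ∷ F) (raise-there r) with raise-superset F r
... | F' , F⊂F' , refl = x ∷ F' , s⊂s F⊂F' , refl
raise-superset [] (raise-there ())

maximal⇒admissible : ∀ {n} (F : Subset n) → IsMaximalDissociation (P n) F →
                     T (admissible (false ∷ word F))
maximal⇒admissible F (D , maximal) with admissible (false ∷ word F) in adm
... | true  = tt
... | false with admissible-defect false (word F) adm
...   | inj₁ notFree = notFree (subst T (sym (tripleFree-word F)) (dissociation⇒tripleFree F D))
...   | inj₂ (w' , r , same) with raise-superset F r
...     | F' , F⊂F' , refl =
  maximal (F' , F⊂F' , tripleFree⇒dissociation F' (subst T freeF' (dissociation⇒tripleFree F D)))
  where
  freeF' : tripleFree (toList F) ≡ tripleFree (toList F')
  freeF' = begin
    tripleFree (toList F)                ≡⟨ tripleFree-word F ⟨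
    tripleFree (false ∷ word F)          ≡⟨ tripleFree-0∷ (false ∷ word F) ⟨
    tripleFree (false ∷ false ∷ word F)  ≡⟨ same false ⟨
    tripleFree (false ∷ false ∷ word F') ≡⟨ tripleFree-0∷ (false ∷ word F') ⟩
    tripleFree (false ∷ word F')         ≡⟨ tripleFree-word F' ⟩
    tripleFree (toList F')               ∎
    where open ≡-Reasoning

transfer : (Bool → Bool → Bool → ℕ) → Bool → Bool → Bool → ℕ
transfer f a b c = through false + through true
  where
  through : Bool → ℕ
  through e = if window3 a b c ∧ window4 a b c e then f b c e else 0

extensions : ℕ → Bool → Bool → Bool → ℕ
extensions zero    a b c = bit (admissible (a ∷ b ∷ c ∷ false ∷ []))
extensions (suc n) a b c = transfer (extensions n) a b c

count-extensions : ∀ n a b c →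
                   count (λ F → admissible (a ∷ b ∷ c ∷ word F)) (allSubsets n) ≡ extensions n a b c
count-extensions zero    a b c = +-identityʳ _
count-extensions (suc n) a b c =
  trans (count-++ p (map (outside ∷_) S) (map (inside ∷_) S)) (cong₂ _+_ (through false) (through true))
  where
  S = allSubsets n
  p : Subset (suc n) → Bool
  p F = admissible (a ∷ b ∷ c ∷ word F)
  through : ∀ e → count p (map (e ∷_) S) ≡ (if window3 a b c ∧ window4 a b c e then extensions n b c e else 0)
  through e = begin
    count p (map (e ∷_) S)
      ≡⟨ count-map p (e ∷_) S ⟩
    count (λ F → window3 a b c ∧ window4 a b c e ∧ admissible (b ∷ c ∷ e ∷ word F)) S
      ≡⟨ count-∧ (window3 a b c) _ S ⟩
    (if window3 a b c then count (λ F → window4 a b c e ∧ admissible (b ∷ c ∷ e ∷ word F)) S else 0)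
      ≡⟨ if-cong-then (window3 a b c) (count-∧ (window4 a b c e) _ S) ⟩
    (if window3 a b c then (if window4 a b c e then count (λ F → admissible (b ∷ c ∷ e ∷ word F)) S else 0) else 0)
      ≡⟨ if-cong-then (window3 a b c) (if-cong-then (window4 a b c e) (count-extensions n b c e)) ⟩
    (if window3 a b c then (if window4 a b c e then extensions n b c e else 0) else 0)
      ≡⟨ if-∧ (window3 a b c) ⟨
    (if window3 a b c ∧ window4 a b c e then extensions n b c e else 0) ∎
    where open ≡-Reasoning

-- Prefixing 1 1 to a word starting with 0 adds only satisfied windows, so the left
-- padding becomes the last letter of the initial state (1, 1, 0).
admissible-110 : ∀ w → admissible (true ∷ true ∷ false ∷ w) ≡ admissible (false ∷ w)
admissible-110 []          = refl
admissible-110 (e ∷ [])    = refl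
admissible-110 (e ∷ f ∷ w) = refl

φ≤extensions : ∀ n → φ (P n) ≤ extensions n true true false
φ≤extensions n = begin
  φ (P n)
    ≤⟨ length-filter≤count (maximalDissociation? (P n)) _ maximal⇒admissible (allSubsets n) ⟩
  count (λ F → admissible (false ∷ word F)) (allSubsets n)
    ≡⟨ count-cong (λ F → admissible-110 (word F)) (allSubsets n) ⟨
  count (λ F → admissible (true ∷ true ∷ false ∷ word F)) (allSubsets n)
    ≡⟨ count-extensions n true true false ⟩
  extensions n true true false ∎
  where open ≤-Reasoning

transfer-mono : ∀ {f g} → (∀ a b c → f a b c ≤ g a b c) → ∀ a b c → transfer f a b c ≤ transfer g a b c
transfer-mono {f} {g} f≤g a b c = +-mono-≤ (through-mono false) (through-mono true)
  where
  through-mono : ∀ e → (if window3 a b c ∧ window4 a b c e then f b c e else 0)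
                     ≤ (if window3 a b c ∧ window4 a b c e then g b c e else 0)
  through-mono e with window3 a b c ∧ window4 a b c e
  ... | true  = f≤g b c e
  ... | false = z≤n

transfer-* : ∀ k f a b c → transfer (λ x y z → k * f x y z) a b c ≡ k * transfer f a b c
transfer-* k f a b c = trans (cong₂ _+_ (through-* false) (through-* true)) (sym (*-distribˡ-+ k _ _))
  where
  through-* : ∀ e → (if window3 a b c ∧ window4 a b c e then k * f b c e else 0)
                  ≡ k * (if window3 a b c ∧ window4 a b c e then f b c e else 0)
  through-* e with window3 a b c ∧ window4 a b c e
  ... | true  = refl
  ... | false = sym (*-zeroʳ k)

-- An approximate eigenvector of the transfer operator for the eigenvalue 3/2.
weight : Bool → Bool → Bool → ℕ
weight false false false = 0
weight false false true  = 2
weight false true  false = 3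
weight false true  true  = 3
weight true  false false = 2
weight true  false true  = 4
weight true  true  false = 4
weight true  true  true  = 0

weight-contracts : ∀ a b c → 2 * transfer weight a b c ≤ 3 * weight a b c
weight-contracts a b c =
  ≤ᵇ⇒≤ _ _ (∀-states-by-computation (λ a b c → 2 * transfer weight a b c ≤ᵇ 3 * weight a b c) a b c)

extensions4≤weight : ∀ a b c → extensions 4 a b c ≤ weight a b c
extensions4≤weight a b c =
  ≤ᵇ⇒≤ _ _ (∀-states-by-computation (λ a b c → extensions 4 a b c ≤ᵇ weight a b c) a b c)

extensions-growth : ∀ m a b c → 2 ^ m * extensions (4 + m) a b c ≤ 3 ^ m * weight a b c
extensions-growth zero    a b c = *-monoʳ-≤ 1 (extensions4≤weight a b c)
extensions-growth (suc m) a b c = begin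
  2 ^ suc m * extensions (5 + m) a b c
    ≡⟨ *-assoc 2 (2 ^ m) _ ⟩
  2 * (2 ^ m * transfer (extensions (4 + m)) a b c)
    ≡⟨ cong (2 *_) (transfer-* (2 ^ m) (extensions (4 + m)) a b c) ⟨
  2 * transfer (λ x y z → 2 ^ m * extensions (4 + m) x y z) a b c
    ≤⟨ *-monoʳ-≤ 2 (transfer-mono (extensions-growth m) a b c) ⟩
  2 * transfer (λ x y z → 3 ^ m * weight x y z) a b c
    ≡⟨ cong (2 *_) (transfer-* (3 ^ m) weight a b c) ⟩
  2 * (3 ^ m * transfer weight a b c)
    ≡⟨ x∙yz≈y∙xz 2 (3 ^ m) _ ⟩
  3 ^ m * (2 * transfer weight a b c)
    ≤⟨ *-monoʳ-≤ (3 ^ m) (weight-contracts a b c) ⟩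
  3 ^ m * (3 * weight a b c)
    ≡⟨ x∙yz≈y∙xz (3 ^ m) 3 _ ⟩
  3 * (3 ^ m * weight a b c)
    ≡⟨ *-assoc 3 (3 ^ m) _ ⟨
  3 ^ suc m * weight a b c ∎
  where open ≤-Reasoning

-- (3/2)^4 = 81/16 < 96/16 = 6, after multiplying through by 16^m.
growth-bound : ∀ {k l} m g → k * 256 < l * 1296 → 2 ^ m * g ≤ 3 ^ m * 4 → k * g ^ 4 < l * 6 ^ (4 + m)
growth-bound {k} {l} m g 256k<1296l 2ᵐg≤4·3ᵐ = *-cancelˡ-< (16 ^ m) _ _ (begin-strict
  16 ^ m * (k * g ^ 4)
    ≡⟨ cong (_* (k * g ^ 4)) ([m^n]^o≡[m^o]^n 2 m 4) ⟨
  (2 ^ m) ^ 4 * (k * g ^ 4)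
    ≡⟨ solve 3 (λ a k x → a :^ 4 :* (k :* x :^ 4) := k :* (a :* x) :^ 4) refl (2 ^ m) k g ⟩
  k * (2 ^ m * g) ^ 4
    ≤⟨ *-monoʳ-≤ k (^-monoˡ-≤ 4 2ᵐg≤4·3ᵐ) ⟩
  k * (3 ^ m * 4) ^ 4
    ≡⟨ solve 2 (λ k b → k :* (b :* con 4) :^ 4 := k :* con 256 :* b :^ 4) refl k (3 ^ m) ⟩
  k * 256 * (3 ^ m) ^ 4
    ≡⟨ cong (k * 256 *_) ([m^n]^o≡[m^o]^n 3 m 4) ⟩
  k * 256 * 81 ^ m
    ≤⟨ *-monoʳ-≤ (k * 256) (^-monoˡ-≤ m (≤ᵇ⇒≤ 81 96 _)) ⟩
  k * 256 * 96 ^ m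
    <⟨ *-monoˡ-< (96 ^ m) {{m^n≢0 96 m}} 256k<1296l ⟩
  l * 1296 * 96 ^ m
    ≡⟨ cong (l * 1296 *_) (^-distribʳ-* 16 6 m) ⟩
  l * 1296 * (16 ^ m * 6 ^ m)
    ≡⟨ solve 3 (λ l s t → l :* con 1296 :* (s :* t)
                       := s :* (l :* (con 6 :* (con 6 :* (con 6 :* (con 6 :* t))))))
               refl l (16 ^ m) (6 ^ m) ⟩
  16 ^ m * (l * 6 ^ (4 + m)) ∎)
  where open ≤-Reasoning

extensions-bound : ∀ n → 1 ≤ n → 10 ^ 8 * extensions n true true false ^ 4 < 81 ^ 4 * 6 ^ n
extensions-bound 1 _ = ≤ᵇ⇒≤ _ _ _
extensions-bound 2 _ = ≤ᵇ⇒≤ _ _ _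
extensions-bound 3 _ = ≤ᵇ⇒≤ _ _ _
extensions-bound (suc (suc (suc (suc m)))) _ =
  growth-bound {10 ^ 8} {81 ^ 4} m _ (≤ᵇ⇒≤ _ _ _) (extensions-growth m true true false)

lemma2p5 : (n : ℕ) → 1 Data.Nat.≤ n →
    (10 ^ 8) * (φ (P n) ^ 4) < (81 ^ 4) * (6 ^ n)
lemma2p5 n 1≤n = ≤-<-trans (*-monoʳ-≤ (10 ^ 8) (^-monoˡ-≤ 4 (φ≤extensions n))) (extensions-bound n 1≤n)
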